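{- Let $E$ be a finite set. The mapping $\nu_E$, sending a Lagrangian subspace $L\subset V_E$ to the set system $(E;\Psi_L)$ with $\Psi_L=\{Y\subset E : L\cap\langle Y^\vee\sqcup(E\setminus Y)\rangle=0\}$, restricts to a bijection between the set of graphic Lagrangian subspaces of $V_E$ and the set of non-degeneracy delta-matroids $(E;\Phi(G))$ of framed graphs $G$ with vertex set $E$.
   Context: Let $E^\vee$ be a disjoint copy of $E$, with $e^\vee$ the copy of $e$; for $Y\subset E$, $Y^\vee=\{e^\vee:e\in Y\}$. $V_E$ is the $\mathbb{F}_2$-vector space with basis $E\sqcup E^\vee$ and symplectic form given on basis vectors by $(e,e^\vee)=(e^\vee,e)=1$ and $(u,v)=0$ for all other pairs of basis vectors. A Lagrangian subspace is a subspace $L$ with $(u,v)=0$ for all $u,v\in L$ and $\dim L=|E|$. Angle brackets denote linear span. A Lagrangian subspace $L\subset V_E$ is graphic if for each $e\in E$ there is $v_e\in L$ with $(v_e,e)=1$ and $(v_e,e')=0$ for all $e'\in E$, $e'\neq e$. A framed graph is a simple graph whose vertices carry frames in $\mathbb{F}_2$; its adjacency matrix $A(G)$ over $\mathbb{F}_2$ has off-diagonal entry $1$ iff the vertices are adjacent and diagonal entries equal to the frames. $G$ is non-degenerate if $\det A(G)=1$ (empty graph counts as non-degenerate). The non-degeneracy delta-matroid of $G$ is $(V(G);\Phi(G))$ where $\Phi(G)$ is the set of $U\subset V(G)$ such that the induced subgraph $G_U$ is non-degenerate. -}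

module Defs where

open import Data.Bool using (Bool; true; false; _∧_; _xor_; if_then_else_)
open import Data.Nat using (ℕ; zero; suc)
open import Data.Fin using (Fin; zero; suc; punchIn; _≟_)
open import Data.Fin.Subset using (Subset)
open import Data.List using (List; []; _∷_; map; length)
import Data.List as List
open import Data.Vec using (Vec; []; _∷_; lookup; tabulate; replicate; zipWith)
open import Data.Product using (Σ; _×_; _,_; ∃)
open import Relation.Binary.PropositionalEquality using (_≡_; _≢_)
open import Relation.Nullary.Decidable using (⌊_⌋)
open import Function.Bundles using (_⇔_)
open import Level using (Level) renaming (suc to lsuc; zero to lzero)

-- F₂ = Bool (xor = +, ∧ = ·).  E = Fin n.

⊕ : ∀ {k} → (Fin k → Bool) → Bool
⊕ {zero}  f = false
⊕ {suc k} f = f zero xor ⊕ (λ i → f (suc i))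

-- V_E = F₂^(E ⊔ E^∨).  A vector is a pair (x , y): x gives the
-- coordinates on the basis vectors e ∈ E, y those on e^∨ ∈ E^∨.

V : ℕ → Set
V n = Vec Bool n × Vec Bool n

0V : ∀ {n} → V n
0V = replicate _ false , replicate _ false

_+V_ : ∀ {n} → V n → V n → V n
(x , y) +V (x' , y') = zipWith _xor_ x x' , zipWith _xor_ y y'

_·V_ : ∀ {n} → Bool → V n → V n
c ·V (x , y) = Data.Vec.map (c ∧_) x , Data.Vec.map (c ∧_) y

δ : ∀ {n} → Fin n → Vec Bool n
δ e = tabulate (λ j → ⌊ e ≟ j ⌋)

basisE : ∀ {n} → Fin n → V n
basisE e = δ e , replicate _ false

basisE∨ : ∀ {n} → Fin n → V n
basisE∨ e = replicate _ false , δ e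

form : ∀ {n} → V n → V n → Bool
form (x , y) (x' , y') =
  ⊕ (λ i → (lookup x i ∧ lookup y' i) xor (lookup y i ∧ lookup x' i))

lincomb : ∀ {n k} → (Fin k → Bool) → (Fin k → V n) → V n
lincomb {k = zero}  c f = 0V
lincomb {k = suc k} c f =
  (c zero ·V f zero) +V lincomb (λ i → c (suc i)) (λ i → f (suc i))

_∈Span_ : ∀ {n k} → V n → (Fin k → V n) → Set
v ∈Span f = ∃ λ c → lincomb c f ≡ v

record Subspace (n : ℕ) : Set₁ where
  field
    mem   : V n → Set
    0∈    : mem 0V
    +∈    : ∀ {u v} → mem u → mem v → mem (u +V v)

open Subspace public

HasDim : ∀ {n} → Subspace n → ℕ → Set
HasDim {n} L k = Σ (Fin k → V n) λ b →
    (∀ i → mem L (b i))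
  × (∀ c → lincomb c b ≡ 0V → ∀ i → c i ≡ false)
  × (∀ v → mem L v → v ∈Span b)

Lagrangian : ∀ {n} → Subspace n → Set
Lagrangian {n} L =
  (∀ u v → mem L u → mem L v → form u v ≡ false) × HasDim L n

Graphic : ∀ {n} → Subspace n → Set
Graphic {n} L = ∀ (e : Fin n) → Σ (V n) λ v →
    mem L v
  × form v (basisE e) ≡ true
  × (∀ e' → e' ≢ e → form v (basisE e') ≡ false)

-- The basis-vector family Y^∨ ⊔ (E ∖ Y): for each e, e^∨ if e ∈ Y, else e.
gen : ∀ {n} → Subset n → Fin n → V n
gen Y e = if lookup Y e then basisE∨ e else basisE e

Ψ : ∀ {n} → Subspace n → Subset n → Set
Ψ L Y = ∀ v → mem L v → v ∈Span gen Y → v ≡ 0V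

record FramedGraph (n : ℕ) : Set where
  field
    adj    : Fin n → Fin n → Bool
    sym    : ∀ i j → adj i j ≡ adj j i
    irrefl : ∀ i → adj i i ≡ false
    frame  : Fin n → Bool

open FramedGraph public

A : ∀ {n} → FramedGraph n → Fin n → Fin n → Bool
A G i j = if ⌊ i ≟ j ⌋ then frame G i else adj G i j

-- determinant over F₂ (Laplace expansion along the first row;
-- signs are irrelevant in characteristic 2); det of 0×0 matrix is 1
det : ∀ {k} → (Fin k → Fin k → Bool) → Bool
det {zero}  M = true
det {suc k} M = ⊕ (λ j → M zero j ∧ det (λ a b → M (suc a) (punchIn j b)))

elems : ∀ {n} → Subset n → List (Fin n)
elems []          = []
elems (true ∷ p)  = zero ∷ map suc (elems p)
elems (false ∷ p) = map suc (elems p)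

A-induced : ∀ {n} → FramedGraph n → (U : Subset n) →
            Fin (length (elems U)) → Fin (length (elems U)) → Bool
A-induced G U i j = A G (List.lookup (elems U) i) (List.lookup (elems U) j)

Φ : ∀ {n} → FramedGraph n → Subset n → Set
Φ G U = det (A-induced G U) ≡ true

SameSystem : ∀ {n} → (Subset n → Set) → (Subset n → Set) → Set
SameSystem P Q = ∀ Y → P Y ⇔ Q Y

SameSubspace : ∀ {n} → Subspace n → Subspace n → Set
SameSubspace L L' = ∀ v → mem L v ⇔ mem L' v

-- A graphic Lagrangian L is the graph {(x, y) : x = y a} of a symmetric F₂-matrix a: the graphic
-- vectors w e have y-part the unit vector at e and their x-parts are the rows of a; isotropy of L makes
-- a symmetric and puts every v ∈ L on the graph, so the dimension condition is automatic.
-- For such L, a vector of L ∩ ⟨Y^∨ ⊔ (E ∖ Y)⟩ is determined by its y-part, which is supported on Y and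
-- lies in the left kernel of the principal submatrix a[Y]; hence Y ∈ Ψ_L iff a[Y] is non-singular iff
-- det a[Y] = 1, i.e. Y ∈ Φ(G) for the framed graph G with adjacency matrix a. Conversely the graph of
-- the adjacency matrix of a framed graph is a graphic Lagrangian. Injectivity: the principal minors
-- of size 1 and 2, a i i and a i i a j j + a i j, recover a from Ψ_L.
-- Over F₂ the facts needed about det (multilinearity, alternation, det M = 1 iff M has trivial
-- kernel) follow from the Laplace expansion along the first row, the last one by Gaussian elimination.

module Submission where

open import Defs hiding (sym)
import Data.Bool as Bool
open import Data.Bool using (Bool; true; false; _∧_; _xor_; not; if_then_else_)
open import Data.Bool.Properties
  using (∧-comm; ∧-assoc; ∧-conicalˡ; ∧-zeroʳ; ∧-identityʳ; ∧-idem; xor-assoc; xor-identityʳ; xor-same;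
         ∧-distribˡ-xor; ∧-distribʳ-xor; ¬-not; not-¬; T-≡; xor-∧-commutativeRing)
open import Data.Nat using (ℕ; zero; suc)
open import Data.Fin using (Fin; zero; suc; punchIn; punchOut; _≟_)
open import Data.Fin.Subset using (Subset)
open import Data.Vec using (Vec; []; _∷_; lookup; tabulate)
open import Data.List using (List)
import Data.List as List
open import Data.List.Membership.Propositional using (_∈_)
open import Data.List.Membership.Propositional.Properties using (∈-map⁺; ∈-map⁻; ∈-lookup)
open import Data.List.Relation.Unary.Any using (here; there; index)
open import Data.List.Relation.Unary.Any.Properties using (lookup-index)
import Data.List.Relation.Unary.All as All
import Data.List.Relation.Unary.All.Properties as All
open import Data.List.Relation.Unary.AllPairs using ([]; _∷_)
open import Data.List.Relation.Unary.Unique.Propositional using (Unique)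
import Data.List.Relation.Unary.Unique.Propositional.Properties as Unique
open import Data.Vec.Properties
  using (lookup∘tabulate; tabulate∘lookup; tabulate-cong; lookup-zipWith; lookup-map; lookup-replicate)
open import Data.Fin.Properties using (any?; suc-injective; punchInᵢ≢i; punchIn-punchOut; punchOut-punchIn)
open import Data.Maybe using (Maybe; just; nothing)
open import Data.Empty using (⊥-elim)
open import Data.Product using (Σ; _×_; _,_; ∃; proj₁; proj₂)
open import Function using (_∘_; id; _⇔_; mk⇔; Equivalence)
open import Function.Construct.Composition using (_⇔-∘_)
open import Function.Construct.Symmetry using (⇔-sym)
open import Relation.Binary.PropositionalEquality
open import Relation.Nullary using (yes; no)
open import Relation.Nullary.Decidable using (⌊_⌋; dec-true; dec-false; isYes≗does; toWitness; fromWitness)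
open import Tactic.RingSolver using (solve-∀)
open import Tactic.RingSolver.Core.AlmostCommutativeRing using (AlmostCommutativeRing; fromCommutativeRing)

𝔽₂ : AlmostCommutativeRing _ _
𝔽₂ = fromCommutativeRing xor-∧-commutativeRing isZero
  where
  isZero : ∀ x → Maybe (false ≡ x)
  isZero false = just refl
  isZero true  = nothing

xor≡false⇒≡ : ∀ a b → a xor b ≡ false → a ≡ b
xor≡false⇒≡ false b e = sym e
xor≡false⇒≡ true  true e = refl

≡true-ext : ∀ a b → (a ≡ true → b ≡ true) → (b ≡ true → a ≡ true) → a ≡ b
≡true-ext false false _ _ = refl
≡true-ext false true  _ g = g refl
≡true-ext true  false f _ = sym (f refl)
≡true-ext true  true  _ _ = refl

infix 4 _==_
_==_ : ∀ {n} → Fin n → Fin n → Bool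
i == j = ⌊ i ≟ j ⌋

==-refl : ∀ {n} (i : Fin n) → (i == i) ≡ true
==-refl i = trans (isYes≗does (i ≟ i)) (dec-true (i ≟ i) refl)

≢⇒==false : ∀ {n} {i j : Fin n} → i ≢ j → (i == j) ≡ false
≢⇒==false {i = i} {j} i≢j = trans (isYes≗does (i ≟ j)) (dec-false (i ≟ j) i≢j)

==⇒≡ : ∀ {n} {i j : Fin n} → (i == j) ≡ true → i ≡ j
==⇒≡ {i = i} {j} e with i ≟ j
... | yes i≡j = i≡j

==-sym : ∀ {n} (i j : Fin n) → (i == j) ≡ (j == i)
==-sym i j with i ≟ j
... | yes refl = sym (==-refl i)
... | no i≢j   = sym (≢⇒==false (≢-sym i≢j))

==-suc : ∀ {n} (a r : Fin n) → (suc a == suc r) ≡ (a == r)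
==-suc a r with a ≟ r
... | yes _ = refl
... | no _  = refl

⊕-cong : ∀ {k} {f g : Fin k → Bool} → f ≗ g → ⊕ f ≡ ⊕ g
⊕-cong {zero}  e = refl
⊕-cong {suc k} e = cong₂ _xor_ (e zero) (⊕-cong (e ∘ suc))

⊕-false : ∀ {k} {f : Fin k → Bool} → (∀ i → f i ≡ false) → ⊕ f ≡ false
⊕-false {zero}  e = refl
⊕-false {suc k} e rewrite e zero = ⊕-false (e ∘ suc)

⊕-distrib-xor : ∀ {k} (f g : Fin k → Bool) → ⊕ (λ i → f i xor g i) ≡ ⊕ f xor ⊕ g
⊕-distrib-xor {zero}  f g = refl
⊕-distrib-xor {suc k} f g =
  trans (cong ((f zero xor g zero) xor_) (⊕-distrib-xor (f ∘ suc) (g ∘ suc)))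
        (interchange (f zero) (g zero) (⊕ (f ∘ suc)) (⊕ (g ∘ suc)))
  where
  interchange : ∀ a b c d → (a xor b) xor (c xor d) ≡ (a xor c) xor (b xor d)
  interchange = solve-∀ 𝔽₂

∧-distribˡ-⊕ : ∀ {k} c (f : Fin k → Bool) → c ∧ ⊕ f ≡ ⊕ (λ i → c ∧ f i)
∧-distribˡ-⊕ {zero}  c f = ∧-zeroʳ c
∧-distribˡ-⊕ {suc k} c f =
  trans (∧-distribˡ-xor c (f zero) _) (cong ((c ∧ f zero) xor_) (∧-distribˡ-⊕ c (f ∘ suc)))

∧-distribʳ-⊕ : ∀ {k} c (f : Fin k → Bool) → ⊕ f ∧ c ≡ ⊕ (λ i → f i ∧ c)
∧-distribʳ-⊕ c f = trans (∧-comm (⊕ f) c) (trans (∧-distribˡ-⊕ c f) (⊕-cong (λ i → ∧-comm c (f i))))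

⊕-comm : ∀ {k m} (f : Fin k → Fin m → Bool) → ⊕ (λ i → ⊕ (f i)) ≡ ⊕ (λ j → ⊕ (λ i → f i j))
⊕-comm {zero} {m} f = sym (⊕-false {m} (λ _ → refl))
⊕-comm {suc k} f =
  trans (cong (⊕ (f zero) xor_) (⊕-comm (f ∘ suc)))
        (sym (⊕-distrib-xor (f zero) (λ j → ⊕ (λ i → f (suc i) j))))

⊕-punchIn : ∀ {k} (f : Fin (suc k) → Bool) j → ⊕ f ≡ f j xor ⊕ (f ∘ punchIn j)
⊕-punchIn f zero = refl
⊕-punchIn {suc k} f (suc j) =
  trans (cong (f zero xor_) (⊕-punchIn (f ∘ suc) j)) (swap (f zero) (f (suc j)) _)
  where
  swap : ∀ a b c → a xor (b xor c) ≡ b xor (a xor c)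
  swap = solve-∀ 𝔽₂

⊕-single : ∀ {k} (f : Fin k → Bool) j → (∀ i → i ≢ j → f i ≡ false) → ⊕ f ≡ f j
⊕-single {suc k} f j off =
  trans (⊕-punchIn f j)
        (trans (cong (f j xor_) (⊕-false (λ l → off (punchIn j l) (punchInᵢ≢i j l)))) (xor-identityʳ (f j)))

⊕-δʳ : ∀ {k} (f : Fin k → Bool) j → ⊕ (λ i → f i ∧ (i == j)) ≡ f j
⊕-δʳ f j = trans (⊕-single _ j (λ i i≢j → trans (cong (f i ∧_) (≢⇒==false i≢j)) (∧-zeroʳ (f i))))
                 (trans (cong (f j ∧_) (==-refl j)) (∧-identityʳ (f j)))

⊕-δˡ : ∀ {k} (f : Fin k → Bool) j → ⊕ (λ i → (j == i) ∧ f i) ≡ f j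
⊕-δˡ f j = trans (⊕-cong (λ i → trans (∧-comm (j == i) (f i)) (cong (f i ∧_) (==-sym j i)))) (⊕-δʳ f j)

⊕²-symmetric : ∀ {k} (f : Fin k → Fin k → Bool) → (∀ i j → f i j ≡ f j i) → (∀ i → f i i ≡ false) →
               ⊕ (λ i → ⊕ (f i)) ≡ false
⊕²-symmetric {zero}  f sym-f diag = refl
⊕²-symmetric {suc k} f sym-f diag = begin
    (f zero zero xor row) xor ⊕ (λ i → f (suc i) zero xor ⊕ (f (suc i) ∘ suc))
  ≡⟨ cong₂ _xor_ (cong (_xor row) (diag zero)) (⊕-distrib-xor (λ i → f (suc i) zero) _) ⟩
    row xor (⊕ (λ i → f (suc i) zero) xor ⊕ (λ i → ⊕ (f (suc i) ∘ suc)))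
  ≡⟨ cong₂ (λ c d → row xor (c xor d)) (⊕-cong (λ i → sym-f (suc i) zero))
           (⊕²-symmetric (λ i j → f (suc i) (suc j)) (λ i j → sym-f (suc i) (suc j)) (diag ∘ suc)) ⟩
    row xor (row xor false)
  ≡⟨ cong (row xor_) (xor-identityʳ row) ⟩
    row xor row
  ≡⟨ xor-same row ⟩
    false
  ∎
  where
  open ≡-Reasoning
  row = ⊕ (f zero ∘ suc)

-- Determinants over F₂

Mat : ℕ → Set
Mat k = Fin k → Fin k → Bool

minor : ∀ {k} → Mat (suc k) → Fin (suc k) → Mat k
minor M j a b = M (suc a) (punchIn j b)

laplaceTerm : ∀ {k} → Mat (suc k) → Fin (suc k) → Bool
laplaceTerm M j = M zero j ∧ det (minor M j)

det-cong : ∀ {k} {M N : Mat k} → (∀ i j → M i j ≡ N i j) → det M ≡ det N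
det-cong {zero}  e = refl
det-cong {suc k} e = ⊕-cong (λ j → cong₂ _∧_ (e zero j) (det-cong (λ a b → e (suc a) (punchIn j b))))

det-linear : ∀ {k} r {M M₁ M₂ : Mat k} →
             (∀ i → i ≢ r → M₁ i ≗ M i) → (∀ i → i ≢ r → M₂ i ≗ M i) →
             (∀ j → M r j ≡ M₁ r j xor M₂ r j) → det M ≡ det M₁ xor det M₂
det-linear {suc k} zero {M} {M₁} {M₂} h₁ h₂ hr =
  trans (⊕-cong term) (⊕-distrib-xor (laplaceTerm M₁) (laplaceTerm M₂))
  where
  same-minor : ∀ {N} → (∀ i → i ≢ zero → N i ≗ M i) → ∀ j → det (minor N j) ≡ det (minor M j)
  same-minor h j = det-cong (λ a b → h (suc a) (λ ()) (punchIn j b))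
  term : ∀ j → laplaceTerm M j ≡ laplaceTerm M₁ j xor laplaceTerm M₂ j
  term j rewrite hr j | same-minor h₁ j | same-minor h₂ j = ∧-distribʳ-xor _ (M₁ zero j) (M₂ zero j)
det-linear {suc k} (suc r) {M} {M₁} {M₂} h₁ h₂ hr =
  trans (⊕-cong term) (⊕-distrib-xor (laplaceTerm M₁) (laplaceTerm M₂))
  where
  term : ∀ j → laplaceTerm M j ≡ laplaceTerm M₁ j xor laplaceTerm M₂ j
  term j rewrite det-linear r {minor M j} {minor M₁ j} {minor M₂ j}
                   (λ a a≢r b → h₁ (suc a) (a≢r ∘ suc-injective) (punchIn j b))
                   (λ a a≢r b → h₂ (suc a) (a≢r ∘ suc-injective) (punchIn j b))
                   (λ b → hr (punchIn j b))
               | h₁ zero (λ ()) j | h₂ zero (λ ()) j = ∧-distribˡ-xor (M zero j) _ _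

det-zeroRow : ∀ {k} (M : Mat k) r → (∀ j → M r j ≡ false) → det M ≡ false
det-zeroRow {suc k} M zero    z = ⊕-false (λ j → cong (_∧ det (minor M j)) (z j))
det-zeroRow {suc k} M (suc r) z =
  ⊕-false (λ j → trans (cong (M zero j ∧_) (det-zeroRow (minor M j) r (z ∘ punchIn j))) (∧-zeroʳ _))

det-zeroColumn : ∀ {k} (M : Mat k) l → (∀ i → M i l ≡ false) → det M ≡ false
det-zeroColumn {suc k} M l z = ⊕-false term
  where
  term : ∀ j → laplaceTerm M j ≡ false
  term j with j ≟ l
  ... | yes refl = cong (_∧ det (minor M j)) (z zero)
  ... | no j≢l   = trans (cong (M zero j ∧_)
                     (det-zeroColumn (minor M j) (punchOut j≢l)
                       (λ a → trans (cong (M (suc a)) (punchIn-punchOut j≢l)) (z (suc a)))))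
                     (∧-zeroʳ _)

setRow : ∀ {k} → Fin k → (Fin k → Bool) → Mat k → Mat k
setRow r v M i = if i == r then v else M i

setRow-≡ : ∀ {k} r v (M : Mat k) → setRow r v M r ≡ v
setRow-≡ r v M rewrite ==-refl r = refl

setRow-≢ : ∀ {k} {r i} v (M : Mat k) → i ≢ r → setRow r v M i ≡ M i
setRow-≢ v M i≢r rewrite ≢⇒==false i≢r = refl

setRow-self : ∀ {k} r (M : Mat k) i → setRow r (M r) M i ≡ M i
setRow-self r M i with i == r in eq
... | true  = cong M (sym (==⇒≡ eq))
... | false = refl

det-setRow-linear : ∀ {k} r (u w : Fin k → Bool) (M : Mat k) →
                    det (setRow r (λ j → u j xor w j) M) ≡ det (setRow r u M) xor det (setRow r w M)
det-setRow-linear r u w M = det-linear r off off row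
  where
  off : ∀ {v} i → i ≢ r → setRow r v M i ≗ setRow r (λ j → u j xor w j) M i
  off {v} i i≢r j = cong-app (trans (setRow-≢ v M i≢r) (sym (setRow-≢ _ M i≢r))) j
  row : ∀ j → setRow r (λ j → u j xor w j) M r j ≡ setRow r u M r j xor setRow r w M r j
  row j rewrite ==-refl r = refl

det-setRow-scale : ∀ {k} r c (v : Fin k → Bool) (M : Mat k) →
                   det (setRow r (λ j → c ∧ v j) M) ≡ c ∧ det (setRow r v M)
det-setRow-scale r false v M = det-zeroRow _ r (cong-app (setRow-≡ r _ M))
det-setRow-scale r true  v M = refl

infixl 7 _*ᴹ_
_*ᴹ_ : ∀ {m k} → (Fin m → Bool) → (Fin m → Fin k → Bool) → Fin k → Bool
(c *ᴹ W) j = ⊕ (λ t → c t ∧ W t j)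

det-setRow-combination : ∀ {k m} r (M : Mat k) (c : Fin m → Bool) (W : Fin m → Fin k → Bool) →
                         det (setRow r (c *ᴹ W) M) ≡ ⊕ (λ t → c t ∧ det (setRow r (W t) M))
det-setRow-combination {m = zero}  r M c W = det-zeroRow _ r (cong-app (setRow-≡ r _ M))
det-setRow-combination {m = suc m} r M c W =
  trans (det-setRow-linear r (λ j → c zero ∧ W zero j) ((c ∘ suc) *ᴹ (W ∘ suc)) M)
        (cong₂ _xor_ (det-setRow-scale r (c zero) (W zero) M) (det-setRow-combination r M (c ∘ suc) (W ∘ suc)))

Alternating : ℕ → Set
Alternating k = ∀ (M : Mat k) {r s} → r ≢ s → M r ≡ M s → det M ≡ false

swapRows : ∀ {k} → Fin k → Fin k → Mat k → Mat k
swapRows r s M = setRow r (M s) (setRow s (M r) M)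

-- In characteristic 2, antisymmetry of an alternating form is symmetry.
swapRows-invariant : ∀ {k} → Alternating k → ∀ (M : Mat k) {r s} → r ≢ s → det (swapRows r s M) ≡ det M
swapRows-invariant alt M {r} {s} r≢s = sym (xor≡false⇒≡ (det M) (det (P b a)) (begin
    det M xor det (P b a)
  ≡⟨ cong₂ _xor_ (det-cong (λ i → cong-app (P-a-b i))) (sym (xor-identityʳ _)) ⟩
    det (P a b) xor (det (P b a) xor false)
  ≡⟨ sym (cong₂ (λ x y → (x xor det (P a b)) xor (det (P b a) xor y)) (diagonal a) (diagonal b)) ⟩
    (det (P a a) xor det (P a b)) xor (det (P b a) xor det (P b b))
  ≡⟨ sym (cong₂ _xor_ (linear-s a) (linear-s b)) ⟩
    det (P a ab) xor det (P b ab)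
  ≡⟨ sym (det-setRow-linear r a b _) ⟩
    det (P ab ab)
  ≡⟨ diagonal ab ⟩
    false
  ∎))
  where
  open ≡-Reasoning
  s≢r = ≢-sym r≢s
  a b ab : Fin _ → Bool
  a = M r
  b = M s
  ab j = a j xor b j
  P : (Fin _ → Bool) → (Fin _ → Bool) → Mat _
  P u w = setRow r u (setRow s w M)
  P-s : ∀ u w → P u w s ≡ w
  P-s u w = trans (setRow-≢ u (setRow s w M) s≢r) (setRow-≡ s w M)
  diagonal : ∀ u → det (P u u) ≡ false
  diagonal u = alt (P u u) r≢s (trans (setRow-≡ r u (setRow s u M)) (sym (P-s u u)))
  linear-s : ∀ u → det (P u ab) ≡ det (P u a) xor det (P u b)
  linear-s u = det-linear s off off
    (cong-app (trans (P-s u ab) (sym (cong₂ (λ x y j → x j xor y j) (P-s u a) (P-s u b)))))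
    where
    off : ∀ {w} i → i ≢ s → P u w i ≗ P u ab i
    off {w} i i≢s j with i == r
    ... | true  = refl
    ... | false = cong-app (trans (setRow-≢ w M i≢s) (sym (setRow-≢ ab M i≢s))) j
  P-a-b : ∀ i → M i ≡ P a b i
  P-a-b i = sym (trans (cong (λ v → setRow r v (setRow s b M) i) (sym (setRow-≢ b M r≢s)))
                 (trans (setRow-self r (setRow s b M) i) (setRow-self s M i)))

minor-swapRows : ∀ {k} r s (M : Mat (suc k)) j a → minor (swapRows (suc r) (suc s) M) j a ≡ swapRows r s (minor M j) a
minor-swapRows r s M j a rewrite ==-suc a r | ==-suc a s with a == r | a == s
... | true  | _     = refl
... | false | true  = refl
... | false | false = refl

det-swapRows-suc : ∀ {k} → Alternating k → ∀ (M : Mat (suc k)) {r s} → r ≢ s →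
                   det (swapRows (suc r) (suc s) M) ≡ det M
det-swapRows-suc alt M {r} {s} r≢s = ⊕-cong (λ j → cong (M zero j ∧_)
  (trans (det-cong (λ a → cong-app (minor-swapRows r s M j a))) (swapRows-invariant alt (minor M j) r≢s)))

punchIn-punchIn-comm : ∀ {n} {j m : Fin (suc (suc n))} (j≢m : j ≢ m) (m≢j : m ≢ j) b →
                       punchIn j (punchIn (punchOut j≢m) b) ≡ punchIn m (punchIn (punchOut m≢j) b)
punchIn-punchIn-comm {j = zero}  {zero}  j≢m _ b = ⊥-elim (j≢m refl)
punchIn-punchIn-comm {j = zero}  {suc m} _   _ b = refl
punchIn-punchIn-comm {j = suc j} {zero}  _   _ b = refl
punchIn-punchIn-comm {suc n} {suc j} {suc m} _ _ zero = refl
punchIn-punchIn-comm {suc n} {suc j} {suc m} j≢m m≢j (suc b) =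
  cong suc (punchIn-punchIn-comm (j≢m ∘ cong suc) (m≢j ∘ cong suc) b)

-- Expanding along both equal rows pairs the term for columns (j, m) with the one for (m, j).
det-equalRows₀₁ : ∀ {k} (M : Mat (suc (suc k))) → M zero ≡ M (suc zero) → det M ≡ false
det-equalRows₀₁ {k} M eq = trans (⊕-cong expand) (⊕²-symmetric F F-sym F-diag)
  where
  N : Fin (suc (suc k)) → Fin (suc k) → Mat k
  N j l a b = M (suc (suc a)) (punchIn j (punchIn l b))
  F : Fin (suc (suc k)) → Fin (suc (suc k)) → Bool
  F j m with j ≟ m
  ... | yes _  = false
  ... | no j≢m = M zero j ∧ (M zero m ∧ det (N j (punchOut j≢m)))
  F-diag : ∀ j → F j j ≡ false
  F-diag j with j ≟ j
  ... | yes _  = refl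
  ... | no j≢j = ⊥-elim (j≢j refl)
  F-sym : ∀ j m → F j m ≡ F m j
  F-sym j m with j ≟ m | m ≟ j
  ... | yes _   | yes _   = refl
  ... | yes j≡m | no m≢j  = ⊥-elim (m≢j (sym j≡m))
  ... | no j≢m  | yes m≡j = ⊥-elim (j≢m (sym m≡j))
  ... | no j≢m  | no m≢j  =
    trans (∧-swap (M zero j) (M zero m) _)
          (cong (λ x → M zero m ∧ (M zero j ∧ x))
                (det-cong (λ a b → cong (M (suc (suc a))) (punchIn-punchIn-comm j≢m m≢j b))))
    where
    ∧-swap : ∀ x y z → x ∧ (y ∧ z) ≡ y ∧ (x ∧ z)
    ∧-swap = solve-∀ 𝔽₂
  F-punchIn : ∀ j l → F j (punchIn j l) ≡ M zero j ∧ (M (suc zero) (punchIn j l) ∧ det (N j l))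
  F-punchIn j l with j ≟ punchIn j l
  ... | yes j≡ = ⊥-elim (punchInᵢ≢i j l (sym j≡))
  ... | no j≢  = cong₂ (λ x y → M zero j ∧ (x ∧ det (N j y))) (cong-app eq (punchIn j l)) (punchOut-punchIn j)
  expand : ∀ j → laplaceTerm M j ≡ ⊕ (F j)
  expand j = trans (∧-distribˡ-⊕ (M zero j) (λ l → M (suc zero) (punchIn j l) ∧ det (N j l)))
                   (sym (trans (⊕-punchIn (F j) j) (cong₂ _xor_ (F-diag j) (⊕-cong (F-punchIn j)))))

det-equalRow₀ : ∀ {k} → Alternating k → (M : Mat (suc k)) (s : Fin k) → M zero ≡ M (suc s) → det M ≡ false
det-equalRow₀ {suc k} alt M zero    eq = det-equalRows₀₁ M eq
-- After swapping rows 1 and t + 2, rows 0 and 1 are M zero and M (suc (suc t)), so eq applies verbatim.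
det-equalRow₀ {suc k} alt M (suc t) eq =
  trans (sym (det-swapRows-suc alt M {zero} {suc t} (λ ()))) (det-equalRows₀₁ (swapRows (suc zero) (suc (suc t)) M) eq)

det-alternating : ∀ k → Alternating k
det-alternating (suc k) M {zero}  {zero}  r≢s eq = ⊥-elim (r≢s refl)
det-alternating (suc k) M {zero}  {suc s} r≢s eq = det-equalRow₀ (det-alternating k) M s eq
det-alternating (suc k) M {suc r} {zero}  r≢s eq = det-equalRow₀ (det-alternating k) M r (sym eq)
det-alternating (suc k) M {suc r} {suc s} r≢s eq = ⊕-false (λ j →
  trans (cong (M zero j ∧_) (det-alternating k (minor M j) (r≢s ∘ cong suc) (cong (_∘ punchIn j) eq))) (∧-zeroʳ _))

det₁ : ∀ (M : Mat 1) → det M ≡ M zero zero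
det₁ M = simplify (M zero zero)
  where
  simplify : ∀ p → (p ∧ true) xor false ≡ p
  simplify = solve-∀ 𝔽₂

det₂ : ∀ (M : Mat 2) → det M ≡ (M zero zero ∧ M (suc zero) (suc zero)) xor (M zero (suc zero) ∧ M (suc zero) zero)
det₂ M = simplify (M zero zero) (M zero (suc zero)) (M (suc zero) zero) (M (suc zero) (suc zero))
  where
  simplify : ∀ p q r s →
             (p ∧ ((s ∧ true) xor false)) xor ((q ∧ ((r ∧ true) xor false)) xor false) ≡ (p ∧ s) xor (q ∧ r)
  simplify = solve-∀ 𝔽₂

-- Determinants and kernels

infix 7 _·_
_·_ : ∀ {k} → (Fin k → Bool) → (Fin k → Bool) → Bool
u · v = ⊕ (λ j → u j ∧ v j)

Kernel : ∀ {k} → Mat k → (Fin k → Bool) → Set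
Kernel M x = ∀ i → M i · x ≡ false

NonSingular : ∀ {k} → Mat k → Set
NonSingular M = ∀ c → (∀ j → (c *ᴹ M) j ≡ false) → ∀ i → c i ≡ false

Symmetric : ∀ {k} → Mat k → Set
Symmetric M = ∀ i j → M i j ≡ M j i

*ᴹ-symmetric : ∀ {k} {M : Mat k} → Symmetric M → ∀ x j → (x *ᴹ M) j ≡ M j · x
*ᴹ-symmetric {M = M} sym-M x j = ⊕-cong (λ t → trans (∧-comm (x t) (M t j)) (cong (_∧ x t) (sym-M t j)))

det-leftKernel : ∀ {k} (M : Mat k) c i → c i ≡ true → (∀ j → (c *ᴹ M) j ≡ false) → det M ≡ false
det-leftKernel {k} M c i cᵢ ker = begin
    det M
  ≡⟨ det-cong (λ l → cong-app (sym (setRow-self i M l))) ⟩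
    det (setRow i (M i) M)
  ≡⟨ cong (_∧ det (setRow i (M i) M)) (sym cᵢ) ⟩
    c i ∧ det (setRow i (M i) M)
  ≡⟨ sym (⊕-single _ i others) ⟩
    ⊕ (λ t → c t ∧ det (setRow i (M t) M))
  ≡⟨ sym (det-setRow-combination i M c M) ⟩
    det (setRow i (c *ᴹ M) M)
  ≡⟨ det-zeroRow _ i (λ j → trans (cong-app (setRow-≡ i _ M) j) (ker j)) ⟩
    false
  ∎
  where
  open ≡-Reasoning
  others : ∀ t → t ≢ i → c t ∧ det (setRow i (M t) M) ≡ false
  others t t≢i = trans (cong (c t ∧_) (det-alternating k _ (≢-sym t≢i)
                   (trans (setRow-≡ i (M t) M) (sym (setRow-≢ (M t) M t≢i))))) (∧-zeroʳ _)

addRow : ∀ {k} → Fin k → Fin k → Bool → Mat k → Mat k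
addRow r s c M = setRow r (λ j → M r j xor (c ∧ M s j)) M

addRow-row : ∀ {k} r s c (M : Mat k) i j → addRow r s c M i j ≡ M i j xor ((c ∧ (r == i)) ∧ M s j)
addRow-row r s c M i j rewrite ==-sym r i with i == r in eq
... | true  = cong₂ _xor_ (cong (λ l → M l j) (sym (==⇒≡ eq))) (cong (_∧ M s j) (sym (∧-identityʳ c)))
... | false = sym (trans (cong (λ z → M i j xor (z ∧ M s j)) (∧-zeroʳ c)) (xor-identityʳ _))

·-linearˡ : ∀ {k} (u v x : Fin k → Bool) c → (λ j → u j xor (c ∧ v j)) · x ≡ u · x xor (c ∧ v · x)
·-linearˡ u v x c =
  trans (⊕-cong (λ j → distrib (u j) c (v j) (x j)))
        (trans (⊕-distrib-xor (λ j → u j ∧ x j) (λ j → c ∧ (v j ∧ x j)))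
               (cong (u · x xor_) (sym (∧-distribˡ-⊕ c (λ j → v j ∧ x j)))))
  where
  distrib : ∀ a c b y → (a xor (c ∧ b)) ∧ y ≡ (a ∧ y) xor (c ∧ (b ∧ y))
  distrib = solve-∀ 𝔽₂

record _↝_ {k} (M N : Mat k) : Set where
  field
    det-≡    : det N ≡ det M
    kernel-⊆ : ∀ x → Kernel N x → Kernel M x

open _↝_

↝-refl : ∀ {k} {M : Mat k} → M ↝ M
↝-refl = record { det-≡ = refl ; kernel-⊆ = λ _ ker → ker }

↝-trans : ∀ {k} {M N P : Mat k} → M ↝ N → N ↝ P → M ↝ P
↝-trans M↝N N↝P = record
  { det-≡    = trans (det-≡ N↝P) (det-≡ M↝N)
  ; kernel-⊆ = λ x → kernel-⊆ M↝N x ∘ kernel-⊆ N↝P x }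

addRow-↝ : ∀ {k} {r s} c (M : Mat k) → r ≢ s → M ↝ addRow r s c M
addRow-↝ {k} {r} {s} c M r≢s = record { det-≡ = det-addRow ; kernel-⊆ = kernel }
  where
  det-addRow : det (addRow r s c M) ≡ det M
  det-addRow =
    trans (det-setRow-linear r (M r) (λ j → c ∧ M s j) M)
     (trans (cong₂ _xor_ (det-cong (λ i → cong-app (setRow-self r M i)))
                         (trans (det-setRow-scale r c (M s) M)
                           (trans (cong (c ∧_) (det-alternating k _ r≢s
                                    (trans (setRow-≡ r (M s) M) (sym (setRow-≢ (M s) M (≢-sym r≢s))))))
                                  (∧-zeroʳ c))))
            (xor-identityʳ (det M)))
  off : ∀ x → Kernel (addRow r s c M) x → ∀ i → i ≢ r → M i · x ≡ false
  off x ker i i≢r = trans (cong (_· x) (sym (setRow-≢ _ M i≢r))) (ker i)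
  kernel : ∀ x → Kernel (addRow r s c M) x → Kernel M x
  kernel x ker i with i ≟ r
  ... | no i≢r   = off x ker i i≢r
  ... | yes refl = xor≡false⇒≡ _ _ (begin
      M r · x xor false
    ≡⟨ cong (M r · x xor_) (sym (trans (cong (c ∧_) (off x ker s (≢-sym r≢s))) (∧-zeroʳ c))) ⟩
      M r · x xor (c ∧ M s · x)
    ≡⟨ sym (·-linearˡ (M r) (M s) x c) ⟩
      (λ j → M r j xor (c ∧ M s j)) · x
    ≡⟨ cong (_· x) (sym (setRow-≡ r _ M)) ⟩
      addRow r s c M r · x
    ≡⟨ ker r ⟩
      false
    ∎)
    where open ≡-Reasoning

addToRows : ∀ {k m} → (Fin m → Fin k) → (Fin m → Bool) → Mat (suc k) → Mat (suc k)
addToRows {m = zero}  ρ c M = M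
addToRows {m = suc m} ρ c M = addRow (suc (ρ zero)) zero (c zero) (addToRows (ρ ∘ suc) (c ∘ suc) M)

addToRows-↝ : ∀ {k m} (ρ : Fin m → Fin k) c (M : Mat (suc k)) → M ↝ addToRows ρ c M
addToRows-↝ {m = zero}  ρ c M = ↝-refl
addToRows-↝ {m = suc m} ρ c M = ↝-trans (addToRows-↝ (ρ ∘ suc) (c ∘ suc) M) (addRow-↝ (c zero) _ (λ ()))

addToRows-row₀ : ∀ {k m} (ρ : Fin m → Fin k) c (M : Mat (suc k)) → addToRows ρ c M zero ≡ M zero
addToRows-row₀ {m = zero}  ρ c M = refl
addToRows-row₀ {m = suc m} ρ c M = addToRows-row₀ (ρ ∘ suc) (c ∘ suc) M

addToRows-row : ∀ {k m} (ρ : Fin m → Fin k) c (M : Mat (suc k)) a j →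
                addToRows ρ c M (suc a) j ≡ M (suc a) j xor (⊕ (λ t → c t ∧ (ρ t == a)) ∧ M zero j)
addToRows-row {m = zero}  ρ c M a j = sym (xor-identityʳ _)
addToRows-row {m = suc m} ρ c M a j = begin
    addRow (suc (ρ zero)) zero (c zero) N (suc a) j
  ≡⟨ addRow-row (suc (ρ zero)) zero (c zero) N (suc a) j ⟩
    N (suc a) j xor ((c zero ∧ (suc (ρ zero) == suc a)) ∧ N zero j)
  ≡⟨ cong₂ (λ u w → u xor ((c zero ∧ w) ∧ N zero j))
           (addToRows-row (ρ ∘ suc) (c ∘ suc) M a j) (==-suc (ρ zero) a) ⟩
    (M (suc a) j xor (rest ∧ M zero j)) xor ((c zero ∧ (ρ zero == a)) ∧ N zero j)
  ≡⟨ cong (λ z → (M (suc a) j xor (rest ∧ M zero j)) xor ((c zero ∧ (ρ zero == a)) ∧ z))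
          (cong-app (addToRows-row₀ (ρ ∘ suc) (c ∘ suc) M) j) ⟩
    (M (suc a) j xor (rest ∧ M zero j)) xor ((c zero ∧ (ρ zero == a)) ∧ M zero j)
  ≡⟨ regroup (M (suc a) j) rest (c zero ∧ (ρ zero == a)) (M zero j) ⟩
    M (suc a) j xor (((c zero ∧ (ρ zero == a)) xor rest) ∧ M zero j)
  ∎
  where
  open ≡-Reasoning
  N = addToRows (ρ ∘ suc) (c ∘ suc) M
  rest = ⊕ (λ t → c (suc t) ∧ (ρ (suc t) == a))
  regroup : ∀ m s q z → (m xor (s ∧ z)) xor (q ∧ z) ≡ m xor ((q xor s) ∧ z)
  regroup = solve-∀ 𝔽₂

pivot : ∀ {k} (M : Mat (suc k)) p → M p zero ≡ true → Σ (Mat (suc k)) λ M₁ → M ↝ M₁ × M₁ zero zero ≡ true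
pivot M p Mₚ₀ with M zero zero in M₀₀
... | true  = M , ↝-refl , M₀₀
pivot M zero    Mₚ₀ | false with () ← trans (sym Mₚ₀) M₀₀
pivot M (suc q) Mₚ₀ | false =
  addRow zero (suc q) true M , addRow-↝ true M (λ ()) , cong₂ _xor_ M₀₀ Mₚ₀

det-firstColumn-unit : ∀ {k} (M : Mat (suc k)) → M zero zero ≡ true → (∀ a → M (suc a) zero ≡ false) →
                       det M ≡ det (minor M zero)
det-firstColumn-unit {zero}  M M₀₀ below = cong (λ x → (x ∧ true) xor false) M₀₀
det-firstColumn-unit {suc k} M M₀₀ below =
  trans (cong₂ _xor_ (cong (_∧ det (minor M zero)) M₀₀) (⊕-false rest)) (xor-identityʳ _)
  where
  rest : ∀ j → laplaceTerm M (suc j) ≡ false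
  rest j = trans (cong (M zero (suc j) ∧_) (det-zeroColumn (minor M (suc j)) zero below)) (∧-zeroʳ _)

NontrivialKernel : ∀ {k} → Mat k → Set
NontrivialKernel M = ∃ λ x → (∃ λ i → x i ≡ true) × Kernel M x

nontrivialKernel-minor₀ : ∀ {k} (M : Mat (suc k)) → M zero zero ≡ true → (∀ a → M (suc a) zero ≡ false) →
                          NontrivialKernel (minor M zero) → NontrivialKernel M
nontrivialKernel-minor₀ M M₀₀ below (d , (i , dᵢ) , ker) = x , (suc i , dᵢ) , kernel
  where
  x : Fin _ → Bool
  x zero    = (M zero ∘ suc) · d
  x (suc b) = d b
  kernel : Kernel M x
  kernel zero    = trans (cong (λ z → (z ∧ x zero) xor x zero) M₀₀) (xor-same (x zero))
  kernel (suc a) = trans (cong (λ z → (z ∧ x zero) xor (M (suc a) ∘ suc) · d) (below a)) (ker a)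

↝-nontrivialKernel : ∀ {k} {M N : Mat k} → M ↝ N → NontrivialKernel N → NontrivialKernel M
↝-nontrivialKernel M↝N (x , nonzero , ker) = x , nonzero , kernel-⊆ M↝N x ker

det≡false⇒nontrivialKernel : ∀ {k} (M : Mat k) → det M ≡ false → NontrivialKernel M
det≡false⇒nontrivialKernel {suc k} M det≡false with any? (λ i → M i zero Bool.≟ true)
... | no noPivot =
  (_== zero) , (zero , ==-refl {suc k} zero) , λ i → trans (⊕-δʳ (M i) zero) (¬-not (noPivot ∘ (i ,_)))
... | yes (p , Mₚ₀) with pivot M p Mₚ₀
...   | M₁ , M↝M₁ , M₁₀₀ =
  ↝-nontrivialKernel M↝M₂
    (nontrivialKernel-minor₀ M₂ M₂₀₀ below (det≡false⇒nontrivialKernel (minor M₂ zero) det-minor))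
  where
  column : Fin k → Bool
  column a = M₁ (suc a) zero
  M₂ : Mat (suc k)
  M₂ = addToRows id column M₁
  M↝M₂ : M ↝ M₂
  M↝M₂ = ↝-trans M↝M₁ (addToRows-↝ id column M₁)
  M₂₀₀ : M₂ zero zero ≡ true
  M₂₀₀ = trans (cong-app (addToRows-row₀ id column M₁) zero) M₁₀₀
  below : ∀ a → M₂ (suc a) zero ≡ false
  below a = trans (addToRows-row id column M₁ a zero)
    (trans (cong₂ (λ c p → column a xor (c ∧ p)) (⊕-δʳ column a) M₁₀₀)
           (trans (cong (column a xor_) (∧-identityʳ _)) (xor-same (column a))))
  det-minor : det (minor M₂ zero) ≡ false
  det-minor = trans (sym (det-firstColumn-unit M₂ M₂₀₀ below)) (trans (det-≡ M↝M₂) det≡false)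

det≡true⇔nonSingular : ∀ {k} (M : Mat k) → Symmetric M → det M ≡ true ⇔ NonSingular M
det≡true⇔nonSingular M sym-M = mk⇔ nonSingular detTrue
  where
  nonSingular : det M ≡ true → NonSingular M
  nonSingular det≡true c ker i with c i in cᵢ
  ... | false = refl
  ... | true with () ← trans (sym det≡true) (det-leftKernel M c i cᵢ ker)
  detTrue : NonSingular M → det M ≡ true
  detTrue ns with det M in det≡
  ... | true  = refl
  ... | false with det≡false⇒nontrivialKernel M det≡
  ...   | x , (i , xᵢ) , ker with () ← trans (sym xᵢ) (ns x (λ j → trans (*ᴹ-symmetric sym-M x j) (ker j)) i)

-- Principal submatrices

⊕-reindex : ∀ {n k} (ι : Fin k → Fin n) → (∀ {i j} → ι i ≡ ι j → i ≡ j) → (g : Fin n → Bool) →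
            (∀ e → g e ≡ true → ∃ λ i → ι i ≡ e) → ⊕ g ≡ ⊕ (g ∘ ι)
⊕-reindex ι ι-injective g supp = begin
    ⊕ g
  ≡⟨ ⊕-cong spread ⟩
    ⊕ (λ e → ⊕ (λ i → (ι i == e) ∧ g e))
  ≡⟨ ⊕-comm (λ e i → (ι i == e) ∧ g e) ⟩
    ⊕ (λ i → ⊕ (λ e → (ι i == e) ∧ g e))
  ≡⟨ ⊕-cong (λ i → ⊕-δˡ g (ι i)) ⟩
    ⊕ (g ∘ ι)
  ∎
  where
  open ≡-Reasoning
  spread : ∀ e → g e ≡ ⊕ (λ i → (ι i == e) ∧ g e)
  spread e with any? (λ i → ι i ≟ e)
  ... | yes (i₀ , refl) =
    sym (trans (⊕-single _ i₀ (λ i i≢i₀ → cong (_∧ g (ι i₀)) (≢⇒==false (i≢i₀ ∘ ι-injective))))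
               (cong (_∧ g (ι i₀)) (==-refl (ι i₀))))
  ... | no ∄i = trans (¬-not (∄i ∘ supp e))
                      (sym (⊕-false (λ i → cong (_∧ g e) (≢⇒==false (∄i ∘ (i ,_))))))

record Enumerates {n k} (S : Subset n) (ι : Fin k → Fin n) : Set where
  field
    injective : ∀ {i j} → ι i ≡ ι j → i ≡ j
    ∈S        : ∀ i → lookup S (ι i) ≡ true
    onto      : ∀ e → lookup S e ≡ true → ∃ λ i → ι i ≡ e

  ==-ι : ∀ i j → (ι i == ι j) ≡ (i == j)
  ==-ι i j with i ≟ j
  ... | yes refl = ==-refl (ι i)
  ... | no i≢j   = ≢⇒==false (i≢j ∘ injective)

  onto-support : ∀ (c : Fin n → Bool) → (∀ e → lookup S e ≡ false → c e ≡ false) →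
                 ∀ e → c e ≡ true → ∃ λ i → ι i ≡ e
  onto-support c supp e cₑ with lookup S e in Sₑ
  ... | true  = onto e Sₑ
  ... | false with () ← trans (sym cₑ) (supp e Sₑ)

NonSingularOn : ∀ {n} → Mat n → Subset n → Set
NonSingularOn a S = ∀ c → (∀ e → lookup S e ≡ false → c e ≡ false) →
                    (∀ f → lookup S f ≡ true → (c *ᴹ a) f ≡ false) → ∀ e → c e ≡ false

restrict : ∀ {n k} → Mat n → (Fin k → Fin n) → Mat k
restrict a ι i j = a (ι i) (ι j)

nonSingularOn⇔nonSingular : ∀ {n k} (a : Mat n) {S : Subset n} {ι : Fin k → Fin n} → Enumerates S ι →
                            NonSingularOn a S ⇔ NonSingular (restrict a ι)
nonSingularOn⇔nonSingular a {S} {ι} enum = mk⇔ toRestriction fromRestriction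
  where
  open Enumerates enum
  reindex : ∀ c → (∀ e → lookup S e ≡ false → c e ≡ false) →
            ∀ f → (c *ᴹ a) f ≡ ((c ∘ ι) *ᴹ (λ i → a (ι i))) f
  reindex c supp f = ⊕-reindex ι injective (λ e → c e ∧ a e f)
                       (λ e cₑaₑ → onto-support c supp e (∧-conicalˡ _ _ cₑaₑ))
  toRestriction : NonSingularOn a S → NonSingular (restrict a ι)
  toRestriction ns x ker i = trans (sym (c-ι i)) (ns c supp kerS (ι i))
    where
    c : Fin _ → Bool
    c e = ⊕ (λ i → x i ∧ (ι i == e))
    c-ι : ∀ j → c (ι j) ≡ x j
    c-ι j = trans (⊕-cong (λ i → cong (x i ∧_) (==-ι i j))) (⊕-δʳ x j)
    supp : ∀ e → lookup S e ≡ false → c e ≡ false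
    supp e Sₑ = ⊕-false λ i →
      trans (cong (x i ∧_) (≢⇒==false (λ ιᵢ≡e → not-¬ (∈S i) (trans (cong (lookup S) ιᵢ≡e) Sₑ)))) (∧-zeroʳ (x i))
    kerS : ∀ f → lookup S f ≡ true → (c *ᴹ a) f ≡ false
    kerS f Sf with onto f Sf
    ... | j , refl = trans (reindex c supp (ι j)) (trans (⊕-cong (λ i → cong (_∧ a (ι i) (ι j)) (c-ι i))) (ker j))
  fromRestriction : NonSingular (restrict a ι) → NonSingularOn a S
  fromRestriction ns c supp kerS e with lookup S e in Sₑ
  ... | false = supp e Sₑ
  ... | true with onto e Sₑ
  ...   | i , refl = ns (c ∘ ι) (λ j → trans (sym (reindex c supp (ι j))) (kerS (ι j) (∈S j))) i

∈elems⇒ : ∀ {n} (S : Subset n) {x} → x ∈ elems S → lookup S x ≡ true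
∈elems⇒ (true ∷ S)  {zero}  _ = refl
∈elems⇒ (true ∷ S)  {suc x} (there x∈) with ∈-map⁻ suc x∈
... | y , y∈ , refl = ∈elems⇒ S y∈
∈elems⇒ (false ∷ S) x∈ with ∈-map⁻ suc x∈
... | y , y∈ , refl = ∈elems⇒ S y∈

⇒∈elems : ∀ {n} (S : Subset n) x → lookup S x ≡ true → x ∈ elems S
⇒∈elems (true ∷ S)  zero    _  = here refl
⇒∈elems (true ∷ S)  (suc x) Sₓ = there (∈-map⁺ suc (⇒∈elems S x Sₓ))
⇒∈elems (false ∷ S) (suc x) Sₓ = ∈-map⁺ suc (⇒∈elems S x Sₓ)

elems-unique : ∀ {n} (S : Subset n) → Unique (elems S)
elems-unique []          = []
elems-unique (true ∷ S)  = All.map⁺ (All.universal (λ _ ()) (elems S)) ∷ Unique.map⁺ suc-injective (elems-unique S)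
elems-unique (false ∷ S) = Unique.map⁺ suc-injective (elems-unique S)

lookup-injective : ∀ {A : Set} {xs : List A} → Unique xs → ∀ {i j} → List.lookup xs i ≡ List.lookup xs j → i ≡ j
lookup-injective (_ ∷ _)  {zero}  {zero}  _  = refl
lookup-injective (x∉ ∷ _) {zero}  {suc j} eq = ⊥-elim (All.lookup x∉ (∈-lookup j) eq)
lookup-injective (x∉ ∷ _) {suc i} {zero}  eq = ⊥-elim (All.lookup x∉ (∈-lookup i) (sym eq))
lookup-injective (_ ∷ u)  {suc i} {suc j} eq = cong suc (lookup-injective u eq)

elems-enumerates : ∀ {n} (S : Subset n) → Enumerates S (List.lookup (elems S))
elems-enumerates S = record
  { injective = lookup-injective (elems-unique S)
  ; ∈S        = λ i → ∈elems⇒ S (∈-lookup i)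
  ; onto      = λ e Sₑ → let e∈ = ⇒∈elems S e Sₑ in index e∈ , sym (lookup-index e∈)
  }

image : ∀ {n k} → (Fin k → Fin n) → Subset n
image ι = tabulate (λ e → ⌊ any? (λ i → ι i ≟ e) ⌋)

image-enumerates : ∀ {n k} (ι : Fin k → Fin n) → (∀ {i j} → ι i ≡ ι j → i ≡ j) → Enumerates (image ι) ι
image-enumerates ι ι-injective = record
  { injective = ι-injective
  ; ∈S        = λ i → trans (lookup∘tabulate _ (ι i)) (Equivalence.to T-≡ (fromWitness (i , refl)))
  ; onto      = λ e inImage →
      toWitness {a? = any? (λ i → ι i ≟ e)} (Equivalence.from T-≡ (trans (sym (lookup∘tabulate _ e)) inImage))
  }

pair : ∀ {n} → Fin n → Fin n → Fin 2 → Fin n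
pair i j zero       = i
pair i j (suc zero) = j

pair-injective : ∀ {n} {i j : Fin n} → i ≢ j → ∀ {x y} → pair i j x ≡ pair i j y → x ≡ y
pair-injective i≢j {zero}     {zero}     _  = refl
pair-injective i≢j {zero}     {suc zero} eq = ⊥-elim (i≢j eq)
pair-injective i≢j {suc zero} {zero}     eq = ⊥-elim (i≢j (sym eq))
pair-injective i≢j {suc zero} {suc zero} _  = refl

X Y : ∀ {n} → V n → Fin n → Bool
X v = lookup (proj₁ v)
Y v = lookup (proj₂ v)

V-ext : ∀ {n} {u v : V n} → X u ≗ X v → Y u ≗ Y v → u ≡ v
V-ext {u = x , y} {x′ , y′} hx hy = cong₂ _,_ (lookup-ext hx) (lookup-ext hy)
  where
  lookup-ext : ∀ {xs ys : Vec Bool _} → lookup xs ≗ lookup ys → xs ≡ ys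
  lookup-ext {xs} {ys} h = trans (sym (tabulate∘lookup xs)) (trans (tabulate-cong h) (tabulate∘lookup ys))

X-0 : ∀ {n} (i : Fin n) → X (0V {n}) i ≡ false
X-0 i = lookup-replicate i false

Y-0 : ∀ {n} (i : Fin n) → Y (0V {n}) i ≡ false
Y-0 i = lookup-replicate i false

X-+ : ∀ {n} (u v : V n) i → X (u +V v) i ≡ X u i xor X v i
X-+ u v i = lookup-zipWith _xor_ i (proj₁ u) (proj₁ v)

Y-+ : ∀ {n} (u v : V n) i → Y (u +V v) i ≡ Y u i xor Y v i
Y-+ u v i = lookup-zipWith _xor_ i (proj₂ u) (proj₂ v)

X-lincomb : ∀ {n k} (c : Fin k → Bool) (w : Fin k → V n) i → X (lincomb c w) i ≡ (c *ᴹ (X ∘ w)) i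
X-lincomb {k = zero}  c w i = X-0 i
X-lincomb {k = suc k} c w i =
  trans (lookup-zipWith _xor_ i (proj₁ (c zero ·V w zero)) (proj₁ (lincomb (c ∘ suc) (w ∘ suc))))
        (cong₂ _xor_ (lookup-map i (c zero ∧_) (proj₁ (w zero))) (X-lincomb (c ∘ suc) (w ∘ suc) i))

Y-lincomb : ∀ {n k} (c : Fin k → Bool) (w : Fin k → V n) i → Y (lincomb c w) i ≡ (c *ᴹ (Y ∘ w)) i
Y-lincomb {k = zero}  c w i = Y-0 i
Y-lincomb {k = suc k} c w i =
  trans (lookup-zipWith _xor_ i (proj₂ (c zero ·V w zero)) (proj₂ (lincomb (c ∘ suc) (w ∘ suc))))
        (cong₂ _xor_ (lookup-map i (c zero ∧_) (proj₂ (w zero))) (Y-lincomb (c ∘ suc) (w ∘ suc) i))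

lincomb∈ : ∀ {n k} (L : Subspace n) (c : Fin k → Bool) (w : Fin k → V n) →
           (∀ t → mem L (w t)) → mem L (lincomb c w)
lincomb∈ {k = zero}  L c w w∈L = 0∈ L
lincomb∈ {k = suc k} L c w w∈L = +∈ L (scale (c zero)) (lincomb∈ L (c ∘ suc) (w ∘ suc) (w∈L ∘ suc))
  where
  x = proj₁ (w zero)
  y = proj₂ (w zero)
  scale : ∀ b → mem L (b ·V w zero)
  scale true  = subst (mem L) (V-ext (λ i → sym (lookup-map i (true ∧_) x)) (λ i → sym (lookup-map i (true ∧_) y)))
                      (w∈L zero)
  scale false = subst (mem L) (V-ext (λ i → trans (X-0 i) (sym (lookup-map i (false ∧_) x)))
                                     (λ i → trans (Y-0 i) (sym (lookup-map i (false ∧_) y)))) (0∈ L)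

δ-lookup : ∀ {n} (e i : Fin n) → lookup (δ e) i ≡ (e == i)
δ-lookup e i = lookup∘tabulate (e ==_) i

form-split : ∀ {n} (u v : V n) → form u v ≡ X u · Y v xor Y u · X v
form-split u v = ⊕-distrib-xor (λ i → X u i ∧ Y v i) (λ i → Y u i ∧ X v i)

form-basisE : ∀ {n} (v : V n) e → form v (basisE e) ≡ Y v e
form-basisE v e = trans (form-split v (basisE e))
  (cong₂ _xor_ (⊕-false (λ i → trans (cong (X v i ∧_) (lookup-replicate i false)) (∧-zeroʳ _)))
               (trans (⊕-cong (λ i → cong (Y v i ∧_) (trans (δ-lookup e i) (==-sym e i)))) (⊕-δʳ (Y v) e)))

X-gen : ∀ {n} (S : Subset n) e i → X (gen S e) i ≡ not (lookup S e) ∧ (e == i)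
X-gen S e i with lookup S e
... | true  = lookup-replicate i false
... | false = δ-lookup e i

Y-gen : ∀ {n} (S : Subset n) e i → Y (gen S e) i ≡ lookup S e ∧ (e == i)
Y-gen S e i with lookup S e
... | true  = δ-lookup e i
... | false = lookup-replicate i false

X-lincomb-gen : ∀ {n} (S : Subset n) c f → X (lincomb c (gen S)) f ≡ c f ∧ not (lookup S f)
X-lincomb-gen S c f = trans (X-lincomb c (gen S) f)
  (trans (⊕-cong (λ e → trans (cong (c e ∧_) (X-gen S e f)) (sym (∧-assoc (c e) _ _))))
         (⊕-δʳ (λ e → c e ∧ not (lookup S e)) f))

Y-lincomb-gen : ∀ {n} (S : Subset n) c f → Y (lincomb c (gen S)) f ≡ c f ∧ lookup S f
Y-lincomb-gen S c f = trans (Y-lincomb c (gen S) f)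
  (trans (⊕-cong (λ e → trans (cong (c e ∧_) (Y-gen S e f)) (sym (∧-assoc (c e) _ _))))
         (⊕-δʳ (λ e → c e ∧ lookup S e) f))

SupportedOn : ∀ {n} → Subset n → V n → Set
SupportedOn S v = (∀ f → lookup S f ≡ true → X v f ≡ false) × (∀ f → lookup S f ≡ false → Y v f ≡ false)

∈Span-gen⇔supportedOn : ∀ {n} (S : Subset n) v → v ∈Span gen S ⇔ SupportedOn S v
∈Span-gen⇔supportedOn S v = mk⇔ supported spanned
  where
  supported : v ∈Span gen S → SupportedOn S v
  supported (c , refl) =
    (λ f Sf → trans (X-lincomb-gen S c f) (trans (cong (λ b → c f ∧ not b) Sf) (∧-zeroʳ (c f)))) ,
    (λ f Sf → trans (Y-lincomb-gen S c f) (trans (cong (c f ∧_) Sf) (∧-zeroʳ (c f))))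
  spanned : SupportedOn S v → v ∈Span gen S
  spanned (noX , noY) = c , V-ext (λ f → trans (X-lincomb-gen S c f) (x-part f))
                                  (λ f → trans (Y-lincomb-gen S c f) (y-part f))
    where
    c : Fin _ → Bool
    c f = if lookup S f then Y v f else X v f
    x-part : ∀ f → c f ∧ not (lookup S f) ≡ X v f
    x-part f with lookup S f in Sf
    ... | true  = trans (∧-zeroʳ _) (sym (noX f Sf))
    ... | false = ∧-identityʳ _
    y-part : ∀ f → c f ∧ lookup S f ≡ Y v f
    y-part f with lookup S f in Sf
    ... | true  = ∧-identityʳ _
    ... | false = trans (∧-zeroʳ _) (sym (noY f Sf))

-- Lagrangians as graphs of symmetric matrices

OnGraph : ∀ {n} → Mat n → V n → Set
OnGraph a v = ∀ f → X v f ≡ (Y v *ᴹ a) f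

record IsGraphOf {n} (L : Subspace n) (a : Mat n) : Set where
  field
    ⊆graph : ∀ {v} → mem L v → OnGraph a v
    graph⊆ : ∀ {v} → OnGraph a v → mem L v

open IsGraphOf

Ψ⇔nonSingularOn : ∀ {n} {L : Subspace n} {a : Mat n} → IsGraphOf L a → ∀ S → Ψ L S ⇔ NonSingularOn a S
Ψ⇔nonSingularOn {L = L} {a} graph S = mk⇔ nonSingular trivialIntersection
  where
  nonSingular : Ψ L S → NonSingularOn a S
  nonSingular ψ c supp ker e = trans (sym (lookup∘tabulate c e)) (trans (cong (λ w → Y w e) v≡0) (Y-0 e))
    where
    v : V _
    v = tabulate (c *ᴹ a) , tabulate c
    v∈L : mem L v
    v∈L = graph⊆ graph λ f →
      trans (lookup∘tabulate (c *ᴹ a) f) (⊕-cong (λ e → cong (_∧ a e f) (sym (lookup∘tabulate c e))))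
    v∈span : v ∈Span gen S
    v∈span = Equivalence.from (∈Span-gen⇔supportedOn S v)
      ((λ f Sf → trans (lookup∘tabulate (c *ᴹ a) f) (ker f Sf)) ,
       (λ f Sf → trans (lookup∘tabulate c f) (supp f Sf)))
    v≡0 : v ≡ 0V
    v≡0 = ψ v v∈L v∈span
  trivialIntersection : NonSingularOn a S → Ψ L S
  trivialIntersection ns v v∈L v∈span =
    V-ext (λ f → trans (onGraph f) (trans (⊕-false (λ e → cong (_∧ a e f) (Y≡0 e))) (sym (X-0 f))))
          (λ e → trans (Y≡0 e) (sym (Y-0 e)))
    where
    onGraph = ⊆graph graph v∈L
    supported = Equivalence.to (∈Span-gen⇔supportedOn S v) v∈span
    Y≡0 : ∀ e → Y v e ≡ false
    Y≡0 = ns (Y v) (proj₂ supported) (λ f Sf → trans (sym (onGraph f)) (proj₁ supported f Sf))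

Isotropic : ∀ {n} → Subspace n → Set
Isotropic L = ∀ u v → mem L u → mem L v → form u v ≡ false

isotropic-graphic⇒isGraphOf : ∀ {n} (L : Subspace n) → Isotropic L → Graphic L →
                              Σ (Mat n) λ a → Symmetric a × IsGraphOf L a
isotropic-graphic⇒isGraphOf {n} L iso graphic = a , a-sym , record { ⊆graph = onGraph _ ; graph⊆ = inL _ }
  where
  w : Fin n → V n
  w e = proj₁ (graphic e)
  w∈L : ∀ e → mem L (w e)
  w∈L e = proj₁ (proj₂ (graphic e))
  a : Mat n
  a e f = X (w e) f
  Y-w : ∀ e i → Y (w e) i ≡ (e == i)
  Y-w e i with i ≟ e
  ... | yes refl = trans (sym (form-basisE (w i) i)) (trans (proj₁ (proj₂ (proj₂ (graphic i)))) (sym (==-refl i)))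
  ... | no i≢e   = trans (sym (form-basisE (w e) i))
                         (trans (proj₂ (proj₂ (proj₂ (graphic e))) i i≢e) (sym (≢⇒==false (≢-sym i≢e))))
  Y-lincomb-w : ∀ y i → Y (lincomb y w) i ≡ y i
  Y-lincomb-w y i = trans (Y-lincomb y w i) (trans (⊕-cong (λ t → cong (y t ∧_) (Y-w t i))) (⊕-δʳ y i))
  form-w : ∀ u f → form u (w f) ≡ X u f xor Y u · X (w f)
  form-w u f = trans (form-split u (w f))
    (cong (_xor Y u · X (w f))
          (trans (⊕-cong (λ i → cong (X u i ∧_) (trans (Y-w f i) (==-sym f i)))) (⊕-δʳ (X u) f)))
  a-sym : Symmetric a
  a-sym e f = xor≡false⇒≡ (a e f) (a f e) (begin
      a e f xor a f e
    ≡⟨ cong (a e f xor_) (sym (trans (⊕-cong (λ i → cong (_∧ a f i) (Y-w e i))) (⊕-δˡ (a f) e))) ⟩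
      a e f xor Y (w e) · X (w f)
    ≡⟨ sym (form-w (w e) f) ⟩
      form (w e) (w f)
    ≡⟨ iso (w e) (w f) (w∈L e) (w∈L f) ⟩
      false
    ∎)
    where open ≡-Reasoning
  inL : ∀ v → OnGraph a v → mem L v
  inL v h = subst (mem L) (V-ext (λ f → trans (X-lincomb (Y v) w f) (sym (h f))) (Y-lincomb-w (Y v)))
                  (lincomb∈ L (Y v) w w∈L)
  -- u = v + Σₑ (Y v e) w e has zero Y-part, so isotropy against w f makes X u f = X v f + (Y v *ᴹ a) f vanish.
  onGraph : ∀ v → mem L v → OnGraph a v
  onGraph v v∈L f = xor≡false⇒≡ _ _ (begin
      X v f xor (Y v *ᴹ a) f
    ≡⟨ sym (trans (X-+ v (lincomb (Y v) w) f) (cong (X v f xor_) (X-lincomb (Y v) w f))) ⟩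
      X u f
    ≡⟨ sym (trans (form-w u f)
                  (trans (cong (X u f xor_) (⊕-false (λ i → cong (_∧ a f i) (Y-u i)))) (xor-identityʳ _))) ⟩
      form u (w f)
    ≡⟨ iso u (w f) (+∈ L v∈L (lincomb∈ L (Y v) w w∈L)) (w∈L f) ⟩
      false
    ∎)
    where
    open ≡-Reasoning
    u = v +V lincomb (Y v) w
    Y-u : ∀ i → Y u i ≡ false
    Y-u i = trans (Y-+ v (lincomb (Y v) w) i) (trans (cong (Y v i xor_) (Y-lincomb-w (Y v) i)) (xor-same (Y v i)))

*ᴹ-distrib-xor : ∀ {n} (y z : Fin n → Bool) (a : Mat n) f →
                 ((λ e → y e xor z e) *ᴹ a) f ≡ (y *ᴹ a) f xor (z *ᴹ a) f
*ᴹ-distrib-xor y z a f =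
  trans (⊕-cong (λ e → ∧-distribʳ-xor (a e f) (y e) (z e))) (⊕-distrib-xor (λ e → y e ∧ a e f) (λ e → z e ∧ a e f))

*ᴹ-adjoint : ∀ {n} {a : Mat n} → Symmetric a → ∀ y z → (y *ᴹ a) · z ≡ y · (z *ᴹ a)
*ᴹ-adjoint {a = a} a-sym y z = begin
    ⊕ (λ i → (y *ᴹ a) i ∧ z i)
  ≡⟨ ⊕-cong (λ i → ∧-distribʳ-⊕ (z i) (λ e → y e ∧ a e i)) ⟩
    ⊕ (λ i → ⊕ (λ e → (y e ∧ a e i) ∧ z i))
  ≡⟨ ⊕-comm (λ i e → (y e ∧ a e i) ∧ z i) ⟩
    ⊕ (λ e → ⊕ (λ i → (y e ∧ a e i) ∧ z i))
  ≡⟨ ⊕-cong (λ e → ⊕-cong (λ i →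
       trans (rearrange (y e) (a e i) (z i)) (cong (λ b → y e ∧ (z i ∧ b)) (a-sym e i)))) ⟩
    ⊕ (λ e → ⊕ (λ i → y e ∧ (z i ∧ a i e)))
  ≡⟨ ⊕-cong (λ e → sym (∧-distribˡ-⊕ (y e) (λ i → z i ∧ a i e))) ⟩
    ⊕ (λ e → y e ∧ (z *ᴹ a) e)
  ∎
  where
  open ≡-Reasoning
  rearrange : ∀ p q r → (p ∧ q) ∧ r ≡ p ∧ (r ∧ q)
  rearrange = solve-∀ 𝔽₂

graphSubspace : ∀ {n} → Mat n → Subspace n
graphSubspace a = record
  { mem = OnGraph a
  ; 0∈  = λ f → trans (X-0 f) (sym (⊕-false (λ e → cong (_∧ a e f) (Y-0 e))))
  ; +∈  = λ {u} {v} u∈ v∈ f → trans (X-+ u v f) (trans (cong₂ _xor_ (u∈ f) (v∈ f))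
            (trans (sym (*ᴹ-distrib-xor (Y u) (Y v) a f)) (⊕-cong (λ e → cong (_∧ a e f) (sym (Y-+ u v e))))))
  }

graphSubspace-isGraphOf : ∀ {n} (a : Mat n) → IsGraphOf (graphSubspace a) a
graphSubspace-isGraphOf a = record { ⊆graph = id ; graph⊆ = id }

graphSubspace-isotropic : ∀ {n} {a : Mat n} → Symmetric a → Isotropic (graphSubspace a)
graphSubspace-isotropic {a = a} a-sym u v u∈ v∈ = begin
    form u v
  ≡⟨ form-split u v ⟩
    X u · Y v xor Y u · X v
  ≡⟨ cong (_xor Y u · X v) (⊕-cong (λ i → cong (_∧ Y v i) (u∈ i))) ⟩
    (Y u *ᴹ a) · Y v xor Y u · X v
  ≡⟨ cong (_xor Y u · X v) (*ᴹ-adjoint a-sym (Y u) (Y v)) ⟩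
    Y u · (Y v *ᴹ a) xor Y u · X v
  ≡⟨ cong (_xor Y u · X v) (⊕-cong (λ i → cong (Y u i ∧_) (sym (v∈ i)))) ⟩
    Y u · X v xor Y u · X v
  ≡⟨ xor-same (Y u · X v) ⟩
    false
  ∎
  where open ≡-Reasoning

graphSubspace-basis : ∀ {n} → Mat n → Fin n → V n
graphSubspace-basis a e = tabulate (a e) , δ e

graphSubspace-basis∈ : ∀ {n} (a : Mat n) e → mem (graphSubspace a) (graphSubspace-basis a e)
graphSubspace-basis∈ a e f =
  trans (lookup∘tabulate (a e) f)
        (sym (trans (⊕-cong (λ t → cong (_∧ a t f) (δ-lookup e t))) (⊕-δˡ (λ t → a t f) e)))

graphSubspace-dim : ∀ {n} (a : Mat n) → HasDim (graphSubspace a) n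
graphSubspace-dim a = b , graphSubspace-basis∈ a , independent , spanning
  where
  b = graphSubspace-basis a
  Y-lincomb-b : ∀ c i → Y (lincomb c b) i ≡ c i
  Y-lincomb-b c i = trans (Y-lincomb c b i) (trans (⊕-cong (λ t → cong (c t ∧_) (δ-lookup t i))) (⊕-δʳ c i))
  independent : ∀ c → lincomb c b ≡ 0V → ∀ i → c i ≡ false
  independent c c·b≡0 i = trans (sym (Y-lincomb-b c i)) (trans (cong (λ v → Y v i) c·b≡0) (Y-0 i))
  spanning : ∀ v → mem (graphSubspace a) v → v ∈Span b
  spanning v v∈ = Y v , V-ext (λ f → trans (X-lincomb (Y v) b f)
                                       (trans (⊕-cong (λ t → cong (Y v t ∧_) (lookup∘tabulate (a t) f))) (sym (v∈ f))))
                              (Y-lincomb-b (Y v))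

graphSubspace-graphic : ∀ {n} (a : Mat n) → Graphic (graphSubspace a)
graphSubspace-graphic a e =
  graphSubspace-basis a e , graphSubspace-basis∈ a e ,
  trans (form-basisE (graphSubspace-basis a e) e) (trans (δ-lookup e e) (==-refl e)) ,
  λ e′ e′≢e → trans (form-basisE (graphSubspace-basis a e) e′)
                     (trans (δ-lookup e e′) (≢⇒==false (≢-sym e′≢e)))

Ψ⇔det : ∀ {n k} {L : Subspace n} {a : Mat n} {S} {ι : Fin k → Fin n} →
        IsGraphOf L a → Symmetric a → Enumerates S ι →
        Ψ L S ⇔ (det (restrict a ι) ≡ true)
Ψ⇔det {a = a} {S} {ι} graph a-sym enum =
  ⇔-sym (det≡true⇔nonSingular (restrict a ι) (λ i j → a-sym (ι i) (ι j)))
    ⇔-∘ (nonSingularOn⇔nonSingular a enum ⇔-∘ Ψ⇔nonSingularOn graph S)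

-- Framed graphs

A-symmetric : ∀ {n} (G : FramedGraph n) → Symmetric (A G)
A-symmetric G i j rewrite ==-sym i j with j == i in eq
... | true  = cong (frame G) (sym (==⇒≡ eq))
... | false = FramedGraph.sym G i j

framedGraph : ∀ {n} (a : Mat n) → Symmetric a → FramedGraph n
framedGraph a a-sym = record
  { adj    = λ i j → if i == j then false else a i j
  ; sym    = λ i j → trans (cong (λ b → if b then false else a i j) (==-sym i j))
                          (cong (if j == i then false else_) (a-sym i j))
  ; irrefl = λ i → cong (λ b → if b then false else a i i) (==-refl i)
  ; frame  = λ i → a i i
  }

A-framedGraph : ∀ {n} (a : Mat n) a-sym i j → A (framedGraph a a-sym) i j ≡ a i j
A-framedGraph a a-sym i j with i == j in eq
... | true  = cong (a i) (==⇒≡ eq)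
... | false = refl

Ψ⇔Φ : ∀ {n} {L : Subspace n} {a : Mat n} (G : FramedGraph n) →
      IsGraphOf L a → Symmetric a → (∀ i j → A G i j ≡ a i j) →
      SameSystem (Ψ L) (Φ G)
Ψ⇔Φ {a = a} G graph a-sym A≡a S =
  mk⇔ (trans det-A≡det-a) (trans (sym det-A≡det-a)) ⇔-∘ Ψ⇔det graph a-sym (elems-enumerates S)
  where
  det-A≡det-a : det (A-induced G S) ≡ det (restrict a (List.lookup (elems S)))
  det-A≡det-a = det-cong (λ i j → A≡a (List.lookup (elems S) i) (List.lookup (elems S) j))

-- For symmetric a the 2×2 principal minor is a i i a j j + a i j², and a i j² = a i j over F₂.
entry-from-minor : ∀ {n} {a : Mat n} → Symmetric a →
                   ∀ i j → a i j ≡ (a i i ∧ a j j) xor det (restrict a (pair i j))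
entry-from-minor {a = a} a-sym i j = sym (begin
    (a i i ∧ a j j) xor det (restrict a (pair i j))
  ≡⟨ cong ((a i i ∧ a j j) xor_) (det₂ (restrict a (pair i j))) ⟩
    (a i i ∧ a j j) xor ((a i i ∧ a j j) xor (a i j ∧ a j i))
  ≡⟨ cong (λ b → (a i i ∧ a j j) xor ((a i i ∧ a j j) xor (a i j ∧ b))) (a-sym j i) ⟩
    (a i i ∧ a j j) xor ((a i i ∧ a j j) xor (a i j ∧ a i j))
  ≡⟨ sym (xor-assoc (a i i ∧ a j j) (a i i ∧ a j j) (a i j ∧ a i j)) ⟩
    ((a i i ∧ a j j) xor (a i i ∧ a j j)) xor (a i j ∧ a i j)
  ≡⟨ cong₂ _xor_ (xor-same (a i i ∧ a j j)) (∧-idem (a i j)) ⟩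
    a i j
  ∎)
  where open ≡-Reasoning

module _ {n} {L L′ : Subspace n} {a a′ : Mat n}
         (graph : IsGraphOf L a) (a-sym : Symmetric a) (graph′ : IsGraphOf L′ a′) (a′-sym : Symmetric a′)
         (same : SameSystem (Ψ L) (Ψ L′)) where

  sameSystem⇒det-restrict-≡ : ∀ {k} (ι : Fin k → Fin n) → (∀ {i j} → ι i ≡ ι j → i ≡ j) →
                              det (restrict a ι) ≡ det (restrict a′ ι)
  sameSystem⇒det-restrict-≡ ι ι-injective = ≡true-ext _ _
    (to ψ′ ∘ to (same (image ι)) ∘ from ψ)
    (to ψ ∘ from (same (image ι)) ∘ from ψ′)
    where
    open Equivalence using (to; from)
    enum = image-enumerates ι ι-injective
    ψ  = Ψ⇔det graph a-sym enum
    ψ′ = Ψ⇔det graph′ a′-sym enum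

  sameSystem⇒sameDiagonal : ∀ i → a i i ≡ a′ i i
  sameSystem⇒sameDiagonal i = trans (sym (det₁ (restrict a (λ _ → i))))
    (trans (sameSystem⇒det-restrict-≡ (λ _ → i) (λ {x} {y} _ → singleton x y)) (det₁ (restrict a′ (λ _ → i))))
    where
    singleton : ∀ (x y : Fin 1) → x ≡ y
    singleton zero zero = refl

  sameSystem⇒sameMatrix : ∀ i j → a i j ≡ a′ i j
  sameSystem⇒sameMatrix i j with i ≟ j
  ... | yes refl = sameSystem⇒sameDiagonal i
  ... | no i≢j   = trans (entry-from-minor a-sym i j) (trans
    (cong₂ _xor_ (cong₂ _∧_ (sameSystem⇒sameDiagonal i) (sameSystem⇒sameDiagonal j))
                 (sameSystem⇒det-restrict-≡ (pair i j) (pair-injective i≢j)))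
    (sym (entry-from-minor a′-sym i j)))

sameMatrix⇒sameSubspace : ∀ {n} {L L′ : Subspace n} {a a′ : Mat n} → IsGraphOf L a → IsGraphOf L′ a′ →
                          (∀ i j → a i j ≡ a′ i j) → SameSubspace L L′
sameMatrix⇒sameSubspace graph graph′ a≡a′ v = mk⇔
  (λ v∈L → graph⊆ graph′ λ f → trans (⊆graph graph v∈L f) (⊕-cong (λ e → cong (Y v e ∧_) (a≡a′ e f))))
  (λ v∈L′ → graph⊆ graph λ f → trans (⊆graph graph′ v∈L′ f) (⊕-cong (λ e → cong (Y v e ∧_) (sym (a≡a′ e f)))))

lemma2p1 : (n : ℕ) →
    -- ν_E maps graphic Lagrangians into non-degeneracy delta-matroids
    ((L : Subspace n) → Lagrangian L → Graphic L →
       Σ (FramedGraph n) λ G → SameSystem (Ψ L) (Φ G))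
    -- every non-degeneracy delta-matroid on E is hit
    × ((G : FramedGraph n) →
       Σ (Subspace n) λ L → Lagrangian L × Graphic L × SameSystem (Ψ L) (Φ G))
    -- ν_E is injective on graphic Lagrangians
    × ((L L' : Subspace n) → Lagrangian L → Graphic L →
       Lagrangian L' → Graphic L' →
       SameSystem (Ψ L) (Ψ L') → SameSubspace L L')
lemma2p1 n = toFramedGraph , fromFramedGraph , injective
  where
  toFramedGraph : (L : Subspace n) → Lagrangian L → Graphic L → Σ (FramedGraph n) λ G → SameSystem (Ψ L) (Φ G)
  toFramedGraph L (iso , _) graphic with isotropic-graphic⇒isGraphOf L iso graphic
  ... | a , a-sym , graph = framedGraph a a-sym , Ψ⇔Φ (framedGraph a a-sym) graph a-sym (A-framedGraph a a-sym)

  fromFramedGraph : (G : FramedGraph n) → Σ (Subspace n) λ L → Lagrangian L × Graphic L × SameSystem (Ψ L) (Φ G)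
  fromFramedGraph G =
    graphSubspace (A G) , (graphSubspace-isotropic (A-symmetric G) , graphSubspace-dim (A G)) ,
    graphSubspace-graphic (A G) , Ψ⇔Φ G (graphSubspace-isGraphOf (A G)) (A-symmetric G) (λ _ _ → refl)

  injective : (L L′ : Subspace n) → Lagrangian L → Graphic L → Lagrangian L′ → Graphic L′ →
              SameSystem (Ψ L) (Ψ L′) → SameSubspace L L′
  injective L L′ (iso , _) graphic (iso′ , _) graphic′ same
    with isotropic-graphic⇒isGraphOf L iso graphic | isotropic-graphic⇒isGraphOf L′ iso′ graphic′
  ... | a , a-sym , graph | a′ , a′-sym , graph′ =
    sameMatrix⇒sameSubspace graph graph′ (sameSystem⇒sameMatrix graph a-sym graph′ a′-sym same)
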